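{- Let $H$ be a graph and let $H'$ be obtained from $H$ by adding isolated vertices. If $H$ is sat-sharp, then $H'$ is sat-sharp; if $H$ is strongly sat-sharp, then $H'$ is strongly sat-sharp. Moreover, $\operatorname{satlim}(H') = \operatorname{satlim}(H)$.
   Context: All graphs are finite and simple. A graph $G$ is $H$-free if it has no subgraph isomorphic to $H$, and $H$-saturated if it is $H$-free and for every non-edge $xy$ of $G$ the graph $G+xy$ contains a subgraph isomorphic to $H$. For $n \geq |V(H)|$, $\operatorname{sat}(H,n)$ is the minimum number of edges of an $H$-saturated graph on $n$ vertices, with the convention $\operatorname{sat}(H,n)=\infty$ if no such graph exists. For an edge $uv$ of $H$, labelled so that $d(u) \leq d(v)$, $\operatorname{wt}(uv) = 2|N(u)\cap N(v)| + |N(v) - N(u)|$ (open neighborhoods in $H$), and $\operatorname{wt}(H) = \min_{uv\in E(H)} \operatorname{wt}(uv)$, with $\operatorname{wt}(H)=\infty$ if $E(H)=\emptyset$. Let $\operatorname{satlim}(H) = \lim_{n\to\infty} \operatorname{sat}(H,n)/n$ when this limit exists. $H$ is sat-sharp if $\operatorname{satlim}(H) = \frac{\operatorname{wt}(H)-1}{2}$, and strongly sat-sharp if $\operatorname{sat}(H,n) = \frac{\operatorname{wt}(H)-1}{2}n + O(1)$ as $n\to\infty$ (by convention, graphs with no edges are strongly sat-sharp). -}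

module Defs where

open import Data.Nat as ℕ using (ℕ; zero; suc; _+_; _*_; _∸_; _≤_; _≥_)
open import Data.Bool using (Bool; true; false; _∧_; _∨_; not; if_then_else_)
open import Data.Fin using (Fin; toℕ; splitAt)
open import Data.Fin.Properties using (_≟_)
open import Data.List using (List; map; allFin)
open import Data.Nat.ListAction using (sum)
open import Data.Sum using (_⊎_; inj₁; inj₂)
open import Data.Product using (Σ; ∃; _×_; _,_)
open import Data.Integer as ℤ using (ℤ; +_)
open import Data.Rational.Unnormalised as ℚ using (ℚᵘ; _/_; 0ℚᵘ)
open import Relation.Binary.PropositionalEquality using (_≡_; _≢_; refl)
open import Relation.Nullary using (¬_)
open import Relation.Nullary.Decidable using (⌊_⌋)
open import Function.Definitions using (Injective)

record Graph (v : ℕ) : Set where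
  field
    adj    : Fin v → Fin v → Bool
    sym    : ∀ i j → adj i j ≡ adj j i
    irrefl : ∀ i → adj i i ≡ false
open Graph public

Edgeless : ∀ {h} → Graph h → Set
Edgeless H = ∀ i j → adj H i j ≡ false

edgeCount : ∀ {n} → Graph n → ℕ
edgeCount {n} G =
  sum (map (λ i → sum (map (λ j →
        if adj G i j ∧ ⌊ toℕ j ℕ.<? toℕ i ⌋ then 1 else 0) (allFin n))) (allFin n))

Contains : ∀ {h g} → Graph h → (Fin g → Fin g → Bool) → Set
Contains {h} {g} H a =
  Σ (Fin h → Fin g) λ f → Injective _≡_ _≡_ f × (∀ i j → adj H i j ≡ true → a (f i) (f j) ≡ true)

addEdge : ∀ {g} → (Fin g → Fin g → Bool) → Fin g → Fin g → (Fin g → Fin g → Bool)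
addEdge a x y i j = a i j ∨ ((⌊ i ≟ x ⌋ ∧ ⌊ j ≟ y ⌋) ∨ (⌊ i ≟ y ⌋ ∧ ⌊ j ≟ x ⌋))

HFree : ∀ {h n} → Graph h → Graph n → Set
HFree H G = ¬ Contains H (adj G)

Saturated : ∀ {h n} → Graph h → Graph n → Set
Saturated H G = HFree H G ×
  (∀ x y → x ≢ y → adj G x y ≡ false → Contains H (addEdge (adj G) x y))

-- IsSat H n k  :  sat(H,n) = k  (finite). If no H-saturated graph on n
-- vertices exists, sat(H,n) = ∞ and IsSat H n k holds for no k.
IsSat : ∀ {h} → Graph h → ℕ → ℕ → Set
IsSat H n k = (Σ (Graph n) λ G → Saturated H G × edgeCount G ≡ k)
            × (∀ (G : Graph n) → Saturated H G → k ≤ edgeCount G)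

rawWt : ∀ {h} → Graph h → Fin h → Fin h → ℕ
rawWt {h} H u v = sum (map (λ w →
  if adj H u w ∧ adj H v w then 2 else (if adj H v w ∧ not (adj H u w) then 1 else 0))
  (allFin h))

degree : ∀ {h} → Graph h → Fin h → ℕ
degree {h} H u = sum (map (λ w → if adj H u w then 1 else 0) (allFin h))

-- wt(uv), with the endpoints labelled so that d(u) ≤ d(v)
edgeWt : ∀ {h} → Graph h → Fin h → Fin h → ℕ
edgeWt H u v = if ⌊ degree H u ℕ.≤? degree H v ⌋ then rawWt H u v else rawWt H v u

-- IsWt H w : wt(H) = w (finite; requires H to have an edge)
IsWt : ∀ {h} → Graph h → ℕ → Set
IsWt H w = (Σ _ λ u → Σ _ λ v → adj H u v ≡ true × edgeWt H u v ≡ w)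
         × (∀ u v → adj H u v ≡ true → w ≤ edgeWt H u v)

-- Limits of sat(H,n)/n  (rationals; n written as suc m to have n ≠ 0)

SatLimIs : ∀ {h} → Graph h → ℚᵘ → Set
SatLimIs H L = ∀ (ε : ℚᵘ) → 0ℚᵘ ℚ.< ε → ∃ λ N → ∀ m → N ≤ m →
  ∃ λ k → IsSat H (suc m) k × ℚ.∣ ((+ k) / suc m) ℚ.- L ∣ ℚ.< ε

-- satlim(H) exists (as a real number): sat(H,n) eventually finite and
-- sat(H,n)/n is a Cauchy sequence of rationals.
SatLimExists : ∀ {h} → Graph h → Set
SatLimExists H = ∀ (ε : ℚᵘ) → 0ℚᵘ ℚ.< ε → ∃ λ N → ∀ m m' → N ≤ m → N ≤ m' →
  ∃ λ k → ∃ λ k' → IsSat H (suc m) k × IsSat H (suc m') k' ×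
    ℚ.∣ ((+ k) / suc m) ℚ.- ((+ k') / suc m') ∣ ℚ.< ε

-- the sequences sat(H,n)/n and sat(H',n)/n have the same limit
-- (their difference tends to 0)
SameSatLim : ∀ {h h'} → Graph h → Graph h' → Set
SameSatLim H H' = ∀ (ε : ℚᵘ) → 0ℚᵘ ℚ.< ε → ∃ λ N → ∀ m → N ≤ m →
  ∃ λ k → ∃ λ k' → IsSat H (suc m) k × IsSat H' (suc m) k' ×
    ℚ.∣ ((+ k) / suc m) ℚ.- ((+ k') / suc m) ∣ ℚ.< ε

-- satlim(H) = (wt(H) - 1)/2 ; for edgeless H both sides are ∞.
SatSharp : ∀ {h} → Graph h → Set
SatSharp H = Edgeless H ⊎
  (Σ ℕ λ w → IsWt H w × SatLimIs H ((+ (w ∸ 1)) / 2))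

-- sat(H,n) = (wt(H)-1)/2 · n + O(1), i.e. |2 sat(H,n) - (wt(H)-1) n| ≤ C
-- for all large n; edgeless graphs are strongly sat-sharp by convention.
StronglySatSharp : ∀ {h} → Graph h → Set
StronglySatSharp H = Edgeless H ⊎
  (Σ ℕ λ w → IsWt H w × ∃ λ C → ∃ λ N → ∀ n → N ≤ n →
     ∃ λ k → IsSat H n k × ℤ.∣ (+ (2 * k)) ℤ.- (+ ((w ∸ 1) * n)) ∣ ≤ C)

-- H' = H plus t isolated vertices (vertices h, …, h+t-1)

isoAdj : ∀ {h t} → (Fin h → Fin h → Bool) → Fin (h + t) → Fin (h + t) → Bool
isoAdj {h} a i j with splitAt h i | splitAt h j
... | inj₁ i' | inj₁ j' = a i' j'
... | inj₁ _  | inj₂ _  = false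
... | inj₂ _  | _       = false

addIsolated : ∀ {h} → Graph h → (t : ℕ) → Graph (h + t)
addIsolated {h} H t = record { adj = isoAdj (adj H) ; sym = s ; irrefl = ir }
  where
  s : ∀ i j → isoAdj {h} {t} (adj H) i j ≡ isoAdj (adj H) j i
  s i j with splitAt h i | splitAt h j
  ... | inj₁ i' | inj₁ j' = sym H i' j'
  ... | inj₁ _  | inj₂ _  = refl
  ... | inj₂ _  | inj₁ _  = refl
  ... | inj₂ _  | inj₂ _  = refl
  ir : ∀ i → isoAdj {h} {t} (adj H) i i ≡ false
  ir i with splitAt h i
  ... | inj₁ i' = irrefl H i'
  ... | inj₂ _  = refl

-- For n ≥ |H'|, a copy of H in a graph on n vertices extends to a copy of H'
-- by sending the isolated vertices to vertices it does not use, and a copy of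
-- H' restricts to a copy of H. Hence H-saturated and H'-saturated graphs on
-- n vertices are the same, and sat(H', n) = sat(H, n) for all n ≥ |H'|; every
-- asymptotic statement about sat therefore transfers. Isolated vertices change
-- no degree, no edge and no edge weight, so wt(H') = wt(H).
module Submission where

open import Defs hiding (sym)
open import Data.Nat using (ℕ; zero; suc; _+_; _∸_; _≤_; _<_)
open import Data.Nat.Properties using (+-suc; m+n≤o⇒m≤o; m+n≤o⇒n≤o; m≤n⇒m≤1+n; <⇒≱)
open import Data.Nat.ListAction using (sum)
open import Data.Fin using (Fin; zero; suc; _↑ˡ_; _↑ʳ_; splitAt; join)
open import Data.Fin.Properties
  using (¬∀⟶∃¬; any?; _≟_; injective⇒≤; ↑ˡ-injective; splitAt-↑ˡ; splitAt-↑ʳ;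
         splitAt⁻¹-↑ˡ; join-splitAt)
open import Data.Vec.Functional using (_∷_)
open import Data.List using (map; tabulate; allFin)
open import Data.List.Properties using (map-tabulate)
open import Data.Sum using (inj₁; inj₂; [_,_]′)
open import Data.Product using (_×_; _,_; Σ; ∃; ∃₂; proj₁; proj₂)
open import Data.Bool using (Bool; true; false; _∧_; not; if_then_else_)
open import Data.Integer using (+_)
open import Data.Rational.Unnormalised using (ℚᵘ; _/_)
open import Data.Empty using (⊥-elim)
open import Function using (_∘_; id)
open import Function.Bundles using (_⇔_; mk⇔; Equivalence)
open import Function.Definitions using (Injective)
open import Relation.Binary.PropositionalEquality
open import Relation.Nullary using (¬_)

open Equivalence using (to; from)

∃-outside-image : ∀ {k g} (f : Fin k → Fin g) → Injective _≡_ _≡_ f → k < g →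
                  ∃ λ y → ∀ a → f a ≢ y
∃-outside-image {k} {g} f f-inj k<g
  with ¬∀⟶∃¬ g (λ y → ∃ λ a → f a ≡ y) (λ y → any? (λ a → f a ≟ y)) ¬surjective
  where
  ¬surjective : ¬ (∀ y → ∃ λ a → f a ≡ y)
  ¬surjective surj = <⇒≱ k<g (injective⇒≤ {f = proj₁ ∘ surj} λ {x} {y} eq →
    trans (sym (proj₂ (surj x))) (trans (cong f eq) (proj₂ (surj y))))
... | y , ∄a = y , λ a fa≡y → ∄a (a , fa≡y)

∷-injective : ∀ {k g} (y : Fin g) (f : Fin k → Fin g) → Injective _≡_ _≡_ f →
              (∀ a → f a ≢ y) → Injective _≡_ _≡_ (y ∷ f)
∷-injective y f f-inj y∉f {zero}  {zero}  eq = refl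
∷-injective y f f-inj y∉f {zero}  {suc b} eq = ⊥-elim (y∉f b (sym eq))
∷-injective y f f-inj y∉f {suc a} {zero}  eq = ⊥-elim (y∉f a eq)
∷-injective y f f-inj y∉f {suc a} {suc b} eq = cong suc (f-inj eq)

∃-disjoint-injection : ∀ t {k g} (f : Fin k → Fin g) → Injective _≡_ _≡_ f → k + t ≤ g →
                       Σ (Fin t → Fin g) λ e → Injective _≡_ _≡_ e × (∀ a b → f a ≢ e b)
∃-disjoint-injection zero    f f-inj k+t≤g = (λ ()) , (λ {}) , λ _ ()
∃-disjoint-injection (suc t) {k} {g} f f-inj k+t≤g =
  let 1+k+t≤g           = subst (_≤ g) (+-suc k t) k+t≤g
      y , y∉f           = ∃-outside-image f f-inj (m+n≤o⇒m≤o (suc k) 1+k+t≤g)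
      e , e-inj , y∷f∉e = ∃-disjoint-injection t (y ∷ f) (∷-injective y f f-inj y∉f) 1+k+t≤g
  in y ∷ e , ∷-injective y e e-inj (λ b eq → y∷f∉e zero b (sym eq)) ,
     λ { a zero → y∉f a ; a (suc b) → y∷f∉e (suc a) b }

[,]-injective : ∀ {a b c} {A : Set a} {B : Set b} {C : Set c} {f : A → C} {e : B → C} →
                Injective _≡_ _≡_ f → Injective _≡_ _≡_ e → (∀ x y → f x ≢ e y) →
                Injective _≡_ _≡_ [ f , e ]′
[,]-injective f-inj e-inj f∉e {inj₁ x} {inj₁ y} eq = cong inj₁ (f-inj eq)
[,]-injective f-inj e-inj f∉e {inj₁ x} {inj₂ y} eq = ⊥-elim (f∉e x y eq)
[,]-injective f-inj e-inj f∉e {inj₂ x} {inj₁ y} eq = ⊥-elim (f∉e y x (sym eq))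
[,]-injective f-inj e-inj f∉e {inj₂ x} {inj₂ y} eq = cong inj₂ (e-inj eq)

splitAt-injective : ∀ m {n} → Injective _≡_ _≡_ (splitAt m {n})
splitAt-injective m {n} {i} {j} eq =
  trans (sym (join-splitAt m n i)) (trans (cong (join m n) eq) (join-splitAt m n j))

sum-allFin-↑ˡ : ∀ h t (φ : Fin (h + t) → ℕ) (ψ : Fin h → ℕ) →
                (∀ a → φ (a ↑ˡ t) ≡ ψ a) → (∀ b → φ (h ↑ʳ b) ≡ 0) →
                sum (map φ (allFin (h + t))) ≡ sum (map ψ (allFin h))
sum-allFin-↑ˡ h t φ ψ φ↑ˡ φ↑ʳ = begin
  sum (map φ (allFin (h + t))) ≡⟨ cong sum (map-tabulate id φ) ⟩
  sum (tabulate φ)             ≡⟨ sum-tabulate h φ ψ φ↑ˡ φ↑ʳ ⟩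
  sum (tabulate ψ)             ≡⟨ cong sum (map-tabulate id ψ) ⟨
  sum (map ψ (allFin h))       ∎
  where
  open ≡-Reasoning
  sum-tabulate-zeros : ∀ {n} (χ : Fin n → ℕ) → (∀ b → χ b ≡ 0) → sum (tabulate χ) ≡ 0
  sum-tabulate-zeros {zero}  χ χ≡0 = refl
  sum-tabulate-zeros {suc n} χ χ≡0 = cong₂ _+_ (χ≡0 zero) (sum-tabulate-zeros (χ ∘ suc) (χ≡0 ∘ suc))
  sum-tabulate : ∀ h (χ : Fin (h + t) → ℕ) (ψ : Fin h → ℕ) →
                 (∀ a → χ (a ↑ˡ t) ≡ ψ a) → (∀ b → χ (h ↑ʳ b) ≡ 0) →
                 sum (tabulate χ) ≡ sum (tabulate ψ)
  sum-tabulate zero    χ ψ _    χ↑ʳ = sum-tabulate-zeros χ χ↑ʳ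
  sum-tabulate (suc h) χ ψ χ↑ˡ χ↑ʳ =
    cong₂ _+_ (χ↑ˡ zero) (sum-tabulate h (χ ∘ suc) (ψ ∘ suc) (χ↑ˡ ∘ suc) χ↑ʳ)

IsSatTransfer : ∀ {h h'} → ℕ → Graph h → Graph h' → Set
IsSatTransfer n₀ H H' = ∀ {n k} → n₀ ≤ n → IsSat H n k → IsSat H' n k

module _ {h h'} (H : Graph h) (H' : Graph h') {n₀ : ℕ} (H⇒H' : IsSatTransfer n₀ H H') where

  eventually-transfer : ∀ {P : ℕ → ℕ → Set} →
    (∃ λ N → ∀ n → N ≤ n → ∃ λ k → IsSat H n k × P n k) →
    (∃ λ N → ∀ n → N ≤ n → ∃ λ k → IsSat H' n k × P n k)
  eventually-transfer (N , bound) = N + n₀ , λ n N+n₀≤n →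
    let k , sat , p = bound n (m+n≤o⇒m≤o N N+n₀≤n)
    in k , H⇒H' (m+n≤o⇒n≤o N N+n₀≤n) sat , p

  satLimIs-transfer : ∀ {L : ℚᵘ} → SatLimIs H L → SatLimIs H' L
  satLimIs-transfer lim ε ε>0 =
    let N , close = lim ε ε>0
    in N + n₀ , λ m N+n₀≤m →
      let k , sat , near = close m (m+n≤o⇒m≤o N N+n₀≤m)
      in k , H⇒H' (m≤n⇒m≤1+n (m+n≤o⇒n≤o N N+n₀≤m)) sat , near

  satLimExists-transfer : SatLimExists H → SatLimExists H'
  satLimExists-transfer cauchy ε ε>0 =
    let N , close = cauchy ε ε>0
    in N + n₀ , λ m m′ N+n₀≤m N+n₀≤m′ →
      let k , k′ , sat , sat′ , near = close m m′ (m+n≤o⇒m≤o N N+n₀≤m) (m+n≤o⇒m≤o N N+n₀≤m′)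
      in k , k′ , H⇒H' (m≤n⇒m≤1+n (m+n≤o⇒n≤o N N+n₀≤m)) sat ,
                  H⇒H' (m≤n⇒m≤1+n (m+n≤o⇒n≤o N N+n₀≤m′)) sat′ , near

  sameSatLim-transfer : SatLimExists H → SameSatLim H H'
  sameSatLim-transfer cauchy ε ε>0 =
    let N , close = cauchy ε ε>0
    in N + n₀ , λ m N+n₀≤m →
      let k , k′ , sat , sat′ , near = close m m (m+n≤o⇒m≤o N N+n₀≤m) (m+n≤o⇒m≤o N N+n₀≤m)
      in k , k′ , sat , H⇒H' (m≤n⇒m≤1+n (m+n≤o⇒n≤o N N+n₀≤m)) sat′ , near

module Padding {h} (H : Graph h) (t : ℕ) where

  H' : Graph (h + t)
  H' = addIsolated H t

  adj-↑ˡ-↑ˡ : ∀ a b → adj H' (a ↑ˡ t) (b ↑ˡ t) ≡ adj H a b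
  adj-↑ˡ-↑ˡ a b rewrite splitAt-↑ˡ h a t | splitAt-↑ˡ h b t = refl

  adj-↑ˡ-↑ʳ : ∀ a b → adj H' (a ↑ˡ t) (h ↑ʳ b) ≡ false
  adj-↑ˡ-↑ʳ a b rewrite splitAt-↑ˡ h a t | splitAt-↑ʳ h t b = refl

  edge-of-H' : ∀ i j → adj H' i j ≡ true →
               ∃₂ λ a b → a ↑ˡ t ≡ i × b ↑ˡ t ≡ j × adj H a b ≡ true
  edge-of-H' i j ij∈H' with splitAt h i in split-i | splitAt h j in split-j
  edge-of-H' i j ab∈H | inj₁ a | inj₁ b = a , b , splitAt⁻¹-↑ˡ split-i , splitAt⁻¹-↑ˡ split-j , ab∈H
  edge-of-H' i j ()   | inj₁ _ | inj₂ _
  edge-of-H' i j ()   | inj₂ _ | _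

  edgeless-H' : Edgeless H → Edgeless H'
  edgeless-H' H-edgeless i j with splitAt h i | splitAt h j
  ... | inj₁ a | inj₁ b = H-edgeless a b
  ... | inj₁ _ | inj₂ _ = refl
  ... | inj₂ _ | _      = refl

  contains-H'⇒contains-H : ∀ {g} (G : Fin g → Fin g → Bool) → Contains H' G → Contains H G
  contains-H'⇒contains-H G (f , f-inj , f-hom) =
    f ∘ (_↑ˡ t) , ↑ˡ-injective t _ _ ∘ f-inj ,
    λ a b ab∈H → f-hom (a ↑ˡ t) (b ↑ˡ t) (trans (adj-↑ˡ-↑ˡ a b) ab∈H)

  contains-H⇒contains-H' : ∀ {g} (G : Fin g → Fin g → Bool) → h + t ≤ g →
                           Contains H G → Contains H' G
  contains-H⇒contains-H' G h+t≤g (f , f-inj , f-hom)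
    with ∃-disjoint-injection t f f-inj h+t≤g
  ... | e , e-inj , f∉e =
    [ f , e ]′ ∘ splitAt h , splitAt-injective h ∘ [,]-injective f-inj e-inj f∉e , F-hom
    where
    F-hom : ∀ i j → adj H' i j ≡ true → G ([ f , e ]′ (splitAt h i)) ([ f , e ]′ (splitAt h j)) ≡ true
    F-hom i j ij∈H' with edge-of-H' i j ij∈H'
    ... | a , b , refl , refl , ab∈H rewrite splitAt-↑ˡ h a t | splitAt-↑ˡ h b t = f-hom a b ab∈H

  contains-H⇔contains-H' : ∀ {g} (G : Fin g → Fin g → Bool) → h + t ≤ g →
                           Contains H G ⇔ Contains H' G
  contains-H⇔contains-H' G h+t≤g =
    mk⇔ (contains-H⇒contains-H' G h+t≤g) (contains-H'⇒contains-H G)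

  saturated-H⇔saturated-H' : ∀ {n} (G : Graph n) → h + t ≤ n → Saturated H G ⇔ Saturated H' G
  saturated-H⇔saturated-H' G h+t≤n = mk⇔
    (λ (free , sat) → free ∘ from (within (adj G)) ,
                      λ x y x≢y xy∉G → to (within (addEdge (adj G) x y)) (sat x y x≢y xy∉G))
    (λ (free , sat) → free ∘ to (within (adj G)) ,
                      λ x y x≢y xy∉G → from (within (addEdge (adj G) x y)) (sat x y x≢y xy∉G))
    where
    within : ∀ A → Contains H A ⇔ Contains H' A
    within A = contains-H⇔contains-H' A h+t≤n

  isSat-H⇔isSat-H' : ∀ {n k} → h + t ≤ n → IsSat H n k ⇔ IsSat H' n k
  isSat-H⇔isSat-H' h+t≤n = mk⇔
    (λ ((G , sat , size) , minimal) →
       (G , to (sat⇔ G) sat , size) , λ G′ sat′ → minimal G′ (from (sat⇔ G′) sat′))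
    (λ ((G , sat , size) , minimal) →
       (G , from (sat⇔ G) sat , size) , λ G′ sat′ → minimal G′ (to (sat⇔ G′) sat′))
    where
    sat⇔ : ∀ G → Saturated H G ⇔ Saturated H' G
    sat⇔ G = saturated-H⇔saturated-H' G h+t≤n

  degree-↑ˡ : ∀ a → degree H' (a ↑ˡ t) ≡ degree H a
  degree-↑ˡ a = sum-allFin-↑ˡ h t _ _
    (λ b → cong (λ x → if x then 1 else 0) (adj-↑ˡ-↑ˡ a b))
    (λ b → cong (λ x → if x then 1 else 0) (adj-↑ˡ-↑ʳ a b))

  rawWt-↑ˡ : ∀ a b → rawWt H' (a ↑ˡ t) (b ↑ˡ t) ≡ rawWt H a b
  rawWt-↑ˡ a b = sum-allFin-↑ˡ h t _ _
    (λ c → cong₂ contribution (adj-↑ˡ-↑ˡ a c) (adj-↑ˡ-↑ˡ b c))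
    (λ c → cong₂ contribution (adj-↑ˡ-↑ʳ a c) (adj-↑ˡ-↑ʳ b c))
    where
    contribution : Bool → Bool → ℕ
    contribution x y = if x ∧ y then 2 else (if y ∧ not x then 1 else 0)

  edgeWt-↑ˡ : ∀ a b → edgeWt H' (a ↑ˡ t) (b ↑ˡ t) ≡ edgeWt H a b
  edgeWt-↑ˡ a b rewrite degree-↑ˡ a | degree-↑ˡ b | rawWt-↑ˡ a b | rawWt-↑ˡ b a = refl

  isWt-H' : ∀ {w} → IsWt H w → IsWt H' w
  isWt-H' {w} ((u , v , uv∈H , wt-uv) , minimal) =
    (u ↑ˡ t , v ↑ˡ t , trans (adj-↑ˡ-↑ˡ u v) uv∈H , trans (edgeWt-↑ˡ u v) wt-uv) , minimal′
    where
    minimal′ : ∀ i j → adj H' i j ≡ true → w ≤ edgeWt H' i j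
    minimal′ i j ij∈H' with edge-of-H' i j ij∈H'
    ... | a , b , refl , refl , ab∈H = subst (w ≤_) (sym (edgeWt-↑ˡ a b)) (minimal a b ab∈H)

  isSat-H⇒isSat-H' : IsSatTransfer (h + t) H H'
  isSat-H⇒isSat-H' h+t≤n = to (isSat-H⇔isSat-H' h+t≤n)

  isSat-H'⇒isSat-H : IsSatTransfer (h + t) H' H
  isSat-H'⇒isSat-H h+t≤n = from (isSat-H⇔isSat-H' h+t≤n)

  satSharp-H' : SatSharp H → SatSharp H'
  satSharp-H' (inj₁ edgeless)       = inj₁ (edgeless-H' edgeless)
  satSharp-H' (inj₂ (w , wt , lim)) =
    inj₂ (w , isWt-H' wt , satLimIs-transfer H H' isSat-H⇒isSat-H' {L = + (w ∸ 1) / 2} lim)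

  stronglySatSharp-H' : StronglySatSharp H → StronglySatSharp H'
  stronglySatSharp-H' (inj₁ edgeless)             = inj₁ (edgeless-H' edgeless)
  stronglySatSharp-H' (inj₂ (w , wt , C , bound)) =
    inj₂ (w , isWt-H' wt , C , eventually-transfer H H' isSat-H⇒isSat-H' bound)

lemma6 : ∀ {h} (H : Graph h) (t : ℕ) →
    (SatSharp H → SatSharp (addIsolated H t))
    × (StronglySatSharp H → StronglySatSharp (addIsolated H t))
    × (SatLimExists H ⇔ SatLimExists (addIsolated H t))
    × (SatLimExists H → SameSatLim H (addIsolated H t))
lemma6 H t =
  satSharp-H' , stronglySatSharp-H' ,
  mk⇔ (satLimExists-transfer H H' isSat-H⇒isSat-H') (satLimExists-transfer H' H isSat-H'⇒isSat-H) ,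
  sameSatLim-transfer H H' isSat-H⇒isSat-H'
  where open Padding H t
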